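{- Let $G$ be a finite graph and $\vec S$ the universe of separations of $G$. If $(T,\alpha)$ is a tame $S$-tree, then $(T,\mathcal V)$ with $\mathcal V=(V_t)_{t\in V(T)}$, $V_t=\mathrm{int}(\sigma_t)$, is a tree-decomposition of $G$. Furthermore, if $(t,t')\in\vec E(T)$ and $\alpha(t,t')=(A,B)$, then $V_t\cap V_{t'}=A\cap B$.
   Context: The universe of separations of $G$ is the set $\vec S$ of ordered pairs $(A,B)$ of subsets of $V(G)$ with $A\cup B=V(G)$ and no edge of $G$ between $A\setminus B$ and $B\setminus A$; it is ordered by $(A,B)\le(C,D)$ iff $A\subseteq C$ and $B\supseteq D$, with involution $(A,B)^*=(B,A)$. A star is a finite multiset $\sigma$ of separations such that any two of its members (distinct as members of the multiset) $(A,B),(C,D)$ satisfy $(A,B)\le(D,C)$. For a star $\sigma=\{(A_0,B_0),\dots,(A_n,B_n)\}$, $\mathrm{int}(\sigma)=\bigcap_{i=0}^n B_i$. An $S$-tree is a pair $(T,\alpha)$ with $T$ a finite tree and $\alpha$ a map from the set $\vec E(T)$ of oriented edges $(x,y)$ of $T$ to $\vec S$ with $\alpha(y,x)=\alpha(x,y)^*$. For $t\in V(T)$, $\vec F_t=\{(x,t)\in\vec E(T)\}$ and $\sigma_t=\alpha(\vec F_t)$ as a multiset; the tree is tame if every $\sigma_t$ is a star. A tree-decomposition of $G$ is a pair $(T,(V_t)_{t\in V(T)})$ with $T$ a tree and $V_t\subseteq V(G)$ such that $V(G)=\bigcup_t V_t$, every edge of $G$ has both ends in some $V_t$, and $V_{t_1}\cap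 V_{t_3}\subseteq V_{t_2}$ whenever $t_2$ lies on the path $t_1Tt_3$. -}

module Defs where

open import Level using (0ℓ)
open import Data.Nat using (ℕ)
open import Data.Fin using (Fin)
open import Data.Bool using (Bool; true)
open import Data.Fin.Subset using (Subset; _∈_; _∉_; _⊆_)
open import Data.Product using (Σ; _×_; _,_; proj₁; proj₂; ∃; ∃-syntax)
open import Data.Sum using (_⊎_)
open import Data.Empty using (⊥)
open import Data.List using (List; _∷_; [])
import Data.List.Membership.Propositional as LMem
open import Data.List.Relation.Unary.Unique.Propositional using (Unique)
open import Relation.Binary.PropositionalEquality using (_≡_; _≢_)
open import Relation.Nullary using (¬_)
open import Relation.Unary using (Pred; _≐_)

record Graph : Set₁ where
  field
    n       : ℕ
    Edge    : Fin n → Fin n → Set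
    sym     : ∀ {u v} → Edge u v → Edge v u
    irrefl  : ∀ {u} → ¬ Edge u u

-- Separations of G.  A subset of V(G) is a 'Subset n' (so ≡ is set equality).

module _ (G : Graph) where
  open Graph G

  SepPair : Set
  SepPair = Subset n × Subset n

  IsSeparation : SepPair → Set
  IsSeparation (A , B) =
    (∀ v → v ∈ A ⊎ v ∈ B) ×
    (∀ u v → Edge u v → u ∈ A → u ∉ B → v ∈ B → v ∉ A → ⊥)

infix 30 _*
infix 4 _≤ₛ_
_* : ∀ {n} → Subset n × Subset n → Subset n × Subset n
(A , B) * = (B , A)

_≤ₛ_ : ∀ {n} → Subset n × Subset n → Subset n × Subset n → Set
(A , B) ≤ₛ (C , D) = A ⊆ C × D ⊆ B

module _ {m : ℕ} (adj : Fin m → Fin m → Bool) where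

  data Walk : Fin m → Fin m → Set where
    [_]    : ∀ u → Walk u u
    _∷⟨_⟩_ : ∀ u {w v} → adj u w ≡ true → Walk w v → Walk u v

  vertices : ∀ {u v} → Walk u v → List (Fin m)
  vertices [ u ] = u ∷ []
  vertices (u ∷⟨ _ ⟩ p) = u ∷ vertices p

  IsPath : ∀ {u v} → Walk u v → Set
  IsPath p = Unique (vertices p)

record Tree : Set where
  field
    m        : ℕ
    adj      : Fin m → Fin m → Bool
    adj-sym  : ∀ {x y} → adj x y ≡ true → adj y x ≡ true
    adj-irr  : ∀ {x} → adj x x ≡ true → ⊥
    nonempty : Fin m
    connected : ∀ u v → Σ (Walk adj u v) (IsPath adj)
    uniquePath : ∀ u v (p q : Walk adj u v) → IsPath adj p → IsPath adj q →
                 vertices adj p ≡ vertices adj q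

  OnPath : Fin m → Fin m → Fin m → Set
  OnPath t₁ t₂ t₃ = Σ (Walk adj t₁ t₃) λ p → IsPath adj p × (t₂ LMem.∈ vertices adj p)

record STree (G : Graph) : Set₁ where
  open Graph G
  field
    T     : Tree
  open Tree T public
  field
    α     : (x y : Fin m) → adj x y ≡ true → SepPair G
    α-sep : ∀ x y (e : adj x y ≡ true) → IsSeparation G (α x y e)
    α-inv : ∀ x y (e : adj x y ≡ true) (e' : adj y x ≡ true) → α y x e' ≡ (α x y e) *

  -- σ_t = α(F⃗_t) is the multiset indexed by the in-edges (x,t); it is a star
  -- if any two members with distinct indices x ≠ x' satisfy α(x,t) ≤ α(x',t)*
  IsStarAt : Fin m → Set
  IsStarAt t = ∀ x x' (e : adj x t ≡ true) (e' : adj x' t ≡ true) → x ≢ x' →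
               α x t e ≤ₛ (α x' t e') *

  Tame : Set
  Tame = ∀ t → IsStarAt t

  -- int(σ_t) = ⋂ { B : (A,B) = α(x,t), (x,t) ∈ F⃗_t }  (empty intersection = V(G))
  int : Fin m → Pred (Fin n) 0ℓ
  int t v = ∀ x (e : adj x t ≡ true) → v ∈ proj₂ (α x t e)

IsTreeDecomposition : (G : Graph) (T : Tree) → (Fin (Tree.m T) → Pred (Fin (Graph.n G)) 0ℓ) → Set
IsTreeDecomposition G T V =
  (∀ v → ∃[ t ] V t v) ×
  (∀ u v → Edge u v → ∃[ t ] (V t u × V t v)) ×
  (∀ t₁ t₂ t₃ → OnPath t₁ t₂ t₃ → ∀ v → V t₁ v → V t₃ v → V t₂ v)
  where open Graph G
        open Tree T

module Submission where

-- Write B(x,t) for the side of α(x,t) facing t, so that v ∈ V_t means v lies on t's side of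
-- every edge at t.  A vertex (or an edge) of G is on t's side or on x's side of each edge {x,t},
-- since A ∪ B = V(G) (resp. since no edge crosses a separation).  Starting anywhere and
-- repeatedly crossing an edge at whose near side it fails, one never crosses back, so in a tree
-- the walk is a path and must stop, at a node t with v ∈ V_t.  Tameness says that if v lies on
-- the far side of an edge (u,u') then v lies on u's side of every other edge at u; pushing this
-- along the path from t₃ back to t₁ and forwards from t₁ gives V_{t₁} ∩ V_{t₃} ⊆ V_{t₂}, and
-- applied at both ends of an edge (t,t') it gives A ∩ B ⊆ V_t ∩ V_{t'}.

open import Defs
open import Axiom.UniquenessOfIdentityProofs using (module Decidable⇒UIP)
open import Data.Bool using (Bool; true; false)
import Data.Bool.Properties as Bool
open import Data.Fin using (Fin; zero; suc; _≟_)
open import Data.Fin.Properties using (injective⇒≤)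
open import Data.Fin.Subset using (Subset; _∈_; _∉_)
open import Data.Fin.Subset.Properties using (_∈?_)
open import Data.List using (List; []; _∷_; head; length; lookup)
open import Data.List.Properties using (∷-injectiveʳ)
open import Data.List.Membership.Propositional using () renaming (_∈_ to _∈ᴸ_; _∉_ to _∉ᴸ_)
open import Data.List.Membership.Propositional.Properties using (∈-lookup)
open import Data.List.Relation.Binary.Subset.Propositional using () renaming (_⊆_ to _⊆ᴸ_)
open import Data.List.Relation.Unary.All as All using ()
open import Data.List.Relation.Unary.All.Properties using (¬Any⇒All¬; anti-mono)
open import Data.List.Relation.Unary.AllPairs using ([]; _∷_)
open import Data.List.Relation.Unary.Any using (here; there)
open import Data.List.Relation.Unary.Unique.Propositional using (Unique)
open import Data.List.Relation.Unary.Unique.Propositional.Properties using (Unique[x∷xs]⇒x∉xs)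
open import Data.Maybe using (just)
open import Data.Maybe.Properties using (just-injective)
open import Data.Nat using (ℕ; zero; suc; _≤_)
open import Data.Nat.Properties using (1+n≰n)
open import Data.Product using (Σ; ∃; ∃-syntax; _×_; _,_; proj₁; proj₂)
import Data.Product as Product
open import Data.Sum using (_⊎_; inj₁; inj₂; [_,_]′)
open import Data.Unit using (⊤; tt)
open import Level using (0ℓ)
open import Function using (_∘_; id)
open import Function.Definitions using (Injective)
open import Relation.Binary.PropositionalEquality
  using (_≡_; _≢_; refl; sym; trans; cong; subst)
open import Relation.Nullary using (¬_; Dec; yes; no; contradiction)
open import Relation.Nullary.Decidable using (_×-dec_; decidable-stable)
open import Relation.Unary using (Pred; _≐_)

≡true-irrelevant : ∀ {b : Bool} (e e' : b ≡ true) → e ≡ e'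
≡true-irrelevant = Decidable⇒UIP.≡-irrelevant Bool._≟_

≡true-dichotomy : ∀ {b : Bool} {Q : b ≡ true → Set} →
                  (∀ e → Dec (Q e)) → (∀ e → Q e) ⊎ ∃ (¬_ ∘ Q)
≡true-dichotomy {false} Q? = inj₁ λ ()
≡true-dichotomy {true} {Q} Q? with Q? refl
... | yes q  = inj₁ λ e → subst Q (≡true-irrelevant refl e) q
... | no ¬q = inj₂ (refl , ¬q)

all-or-counterexample : ∀ {n} {Q W : Pred (Fin n) 0ℓ} →
                        (∀ i → Q i ⊎ W i) → (∀ i → Q i) ⊎ ∃ W
all-or-counterexample {zero}  _ = inj₁ λ ()
all-or-counterexample {suc n} f with f zero | all-or-counterexample (f ∘ suc)
... | inj₂ w | _            = inj₂ (zero , w)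
... | inj₁ _ | inj₂ (i , w) = inj₂ (suc i , w)
... | inj₁ q | inj₁ qs      = inj₁ λ { zero → q ; (suc i) → qs i }

lookup-injective : ∀ {A : Set} {xs : List A} → Unique xs → Injective _≡_ _≡_ (lookup xs)
lookup-injective {xs = _ ∷ _} _        {zero}  {zero}  _  = refl
lookup-injective {xs = _ ∷ _} u        {zero}  {suc j} eq =
  contradiction (subst (_∈ᴸ _) (sym eq) (∈-lookup j)) (Unique[x∷xs]⇒x∉xs u)
lookup-injective {xs = _ ∷ _} u        {suc i} {zero}  eq =
  contradiction (subst (_∈ᴸ _) eq (∈-lookup i)) (Unique[x∷xs]⇒x∉xs u)
lookup-injective {xs = _ ∷ _} (_ ∷ u) {suc i} {suc j} eq = cong suc (lookup-injective u eq)

Unique⇒length≤ : ∀ {m} {xs : List (Fin m)} → Unique xs → length xs ≤ m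
Unique⇒length≤ u = injective⇒≤ (lookup-injective u)

module SeparationProperties (G : Graph) where
  open Graph G using (n; Edge)

  module _ {A B : Subset n} (sep : IsSeparation G (A , B)) where

    ∉B⇒∈A : ∀ {v} → v ∉ B → v ∈ A
    ∉B⇒∈A {v} v∉B = [ id , (λ v∈B → contradiction v∈B v∉B) ]′ (proj₁ sep v)

    ∉A⇒∈B : ∀ {v} → v ∉ A → v ∈ B
    ∉A⇒∈B {v} v∉A = [ (λ v∈A → contradiction v∈A v∉A) , id ]′ (proj₁ sep v)

    neighbour-of-A∖B∈A : ∀ {u v} → Edge u v → u ∉ B → v ∈ A
    neighbour-of-A∖B∈A uv u∉B = decidable-stable (_ ∈? A) λ v∉A →
      proj₂ sep _ _ uv (∉B⇒∈A u∉B) u∉B (∉A⇒∈B v∉A) v∉A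

    edge-within-side : ∀ {u v} → Edge u v → (u ∈ A × v ∈ A) ⊎ (u ∈ B × v ∈ B)
    edge-within-side {u} {v} uv with u ∈? B | v ∈? B
    ... | yes u∈B | yes v∈B = inj₂ (u∈B , v∈B)
    ... | no u∉B  | _       = inj₁ (∉B⇒∈A u∉B , neighbour-of-A∖B∈A uv u∉B)
    ... | _       | no v∉B  = inj₁ (neighbour-of-A∖B∈A (Graph.sym G uv) v∉B , ∉B⇒∈A v∉B)

module TreeProperties (T : Tree) where
  open Tree T

  head-vertices : ∀ {u w} (p : Walk adj u w) → head (vertices adj p) ≡ just u
  head-vertices [ _ ]        = refl
  head-vertices (_ ∷⟨ _ ⟩ _) = refl

  start∈vertices : ∀ {u w} (p : Walk adj u w) → u ∈ᴸ vertices adj p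
  start∈vertices [ _ ]        = here refl
  start∈vertices (_ ∷⟨ _ ⟩ _) = here refl

  vertices-injective-start : ∀ {u u' w} (p : Walk adj u w) (q : Walk adj u' w) →
                             vertices adj p ≡ vertices adj q → u ≡ u'
  vertices-injective-start p q eq =
    just-injective (trans (sym (head-vertices p)) (trans (cong head eq) (head-vertices q)))

  suffix : ∀ {u w y} (p : Walk adj u w) → y ∈ᴸ vertices adj p →
           Σ (Walk adj y w) λ s → vertices adj s ⊆ᴸ vertices adj p × (IsPath adj p → IsPath adj s)
  suffix [ _ ]        (here refl) = [ _ ] , id , id
  suffix (_ ∷⟨ e ⟩ p) (here refl) = _ ∷⟨ e ⟩ p , id , id
  suffix (_ ∷⟨ _ ⟩ p) (there y∈p) with suffix p y∈p
  ... | s , s⊆p , path⇒path = s , there ∘ s⊆p , λ { (_ ∷ path-p) → path⇒path path-p }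

  -- Otherwise t ∷ y ∷ (the rest of the path from y) would be a second path with the same ends.
  neighbour∉path : ∀ {t a y w} {p : Walk adj a w} (e : adj t a ≡ true) →
                   IsPath adj (t ∷⟨ e ⟩ p) → adj y t ≡ true → y ≢ a →
                   y ∉ᴸ vertices adj (t ∷⟨ e ⟩ p)
  neighbour∉path _ _ yt _ (here refl) = adj-irr yt
  neighbour∉path {t} {p = p} e (t∉p ∷ path-p) yt y≢a (there y∈p) with suffix p y∈p
  ... | s , s⊆p , path⇒path =
    y≢a (sym (vertices-injective-start p s (∷-injectiveʳ same-vertices)))
    where
    same-vertices : vertices adj (t ∷⟨ e ⟩ p) ≡ vertices adj (t ∷⟨ adj-sym yt ⟩ s)
    same-vertices = uniquePath t _ (t ∷⟨ e ⟩ p) (t ∷⟨ adj-sym yt ⟩ s)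
      (t∉p ∷ path-p) (anti-mono s⊆p t∉p ∷ path⇒path path-p)

  module _ (P : (x t : Fin m) → adj x t ≡ true → Set)
           (P? : ∀ x t e → Dec (P x t e))
           (oriented : ∀ x t e e' → P x t e ⊎ P t x e') where

    Sink : Fin m → Set
    Sink t = ∀ x e → P x t e

    BadFirstEdge : ∀ {u w} → Walk adj u w → Set
    BadFirstEdge [ _ ]        = ⊤
    BadFirstEdge (_ ∷⟨ e ⟩ _) = ¬ P _ _ e

    record Descent (k : ℕ) : Set where
      constructor descent
      field
        {start}  : Fin m
        walk     : Walk adj start nonempty
        isPath   : IsPath adj walk
        badFirst : BadFirstEdge walk
        length≡  : length (vertices adj walk) ≡ k

    sink-or-bad-in-edge : ∀ t → Sink t ⊎ ∃[ y ] Σ (adj y t ≡ true) (¬_ ∘ P y t)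
    sink-or-bad-in-edge t = all-or-counterexample (λ y → ≡true-dichotomy (P? y t))

    bad-in-edge∉descent : ∀ {t y} {p : Walk adj t nonempty} → IsPath adj p → BadFirstEdge p →
                          (e : adj y t ≡ true) → ¬ P y t e → y ∉ᴸ vertices adj p
    bad-in-edge∉descent {p = [ _ ]} _ _ e _ (here refl) = adj-irr e
    bad-in-edge∉descent {p = [ _ ]} _ _ _ _ (there ())
    bad-in-edge∉descent {p = _ ∷⟨ e₀ ⟩ _} path-p ¬Pta e ¬Pat =
      neighbour∉path e₀ path-p e λ { refl → [ ¬Pat , ¬Pta ]′ (oriented _ _ e e₀) }

    descend : ∀ {k} → Descent k → ∃ Sink ⊎ Descent (suc k)
    descend (descent {t} p path-p bad-p len) with sink-or-bad-in-edge t
    ... | inj₁ sink = inj₁ (t , sink)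
    ... | inj₂ (y , e , ¬Pyt) = inj₂ (descent (y ∷⟨ e ⟩ p)
      (¬Any⇒All¬ _ (bad-in-edge∉descent path-p bad-p e ¬Pyt) ∷ path-p) ¬Pyt (cong suc len))

    sink-or-descent : ∀ k → ∃ Sink ⊎ Descent (suc k)
    sink-or-descent zero    = inj₂ (descent [ nonempty ] (All.[] ∷ []) tt refl)
    sink-or-descent (suc k) = [ inj₁ , descend ]′ (sink-or-descent k)

    ∃-sink : ∃ Sink
    ∃-sink with sink-or-descent m
    ... | inj₁ sink = sink
    ... | inj₂ (descent _ path-p _ len) =
      contradiction (subst (_≤ m) len (Unique⇒length≤ path-p)) 1+n≰n

module STreeProperties {G : Graph} (S : STree G) where
  open Graph G using (n; Edge)
  open STree S
  open SeparationProperties G using (edge-within-side)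
  open TreeProperties T using (start∈vertices; ∃-sink)

  A B : (x t : Fin m) → adj x t ≡ true → Subset n
  A x t e = proj₁ (α x t e)
  B x t e = proj₂ (α x t e)

  B-reverse : ∀ {x t} (e : adj x t ≡ true) (e' : adj t x ≡ true) → B t x e' ≡ A x t e
  B-reverse e e' = cong proj₂ (α-inv _ _ e e')

  A⊆B-reverse : ∀ {x t v} (e : adj x t ≡ true) (e' : adj t x ≡ true) → v ∈ A x t e → v ∈ B t x e'
  A⊆B-reverse e e' = subst (_ ∈_) (sym (B-reverse e e'))

  B-reverse⊆A : ∀ {x t v} (e : adj x t ≡ true) (e' : adj t x ≡ true) → v ∈ B t x e' → v ∈ A x t e
  B-reverse⊆A e e' = subst (_ ∈_) (B-reverse e e')

  vertex-covered : ∀ v → ∃[ t ] int t v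
  vertex-covered v = ∃-sink (λ x t e → v ∈ B x t e) (λ x t e → v ∈? B x t e)
    λ x t e e' → [ inj₂ ∘ A⊆B-reverse e e' , inj₁ ]′ (proj₁ (α-sep x t e) v)

  edge-covered : ∀ u v → Edge u v → ∃[ t ] (int t u × int t v)
  edge-covered u v uv = Product.map₂ split (∃-sink P P? oriented)
    where
    P : (x t : Fin m) → adj x t ≡ true → Set
    P x t e = u ∈ B x t e × v ∈ B x t e

    P? : ∀ x t e → Dec (P x t e)
    P? x t e = (u ∈? B x t e) ×-dec (v ∈? B x t e)

    oriented : ∀ x t e e' → P x t e ⊎ P t x e'
    oriented x t e e' = [ inj₂ ∘ Product.map (A⊆B-reverse e e') (A⊆B-reverse e e') , inj₁ ]′
                          (edge-within-side (α-sep x t e) uv)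

    split : ∀ {t} → (∀ x e → P x t e) → int t u × int t v
    split h = (λ x e → proj₁ (h x e)) , (λ x e → proj₂ (h x e))

  module _ (tame : Tame) where

    star-∈B : ∀ {x u u' v} (e : adj x u ≡ true) (e' : adj u u' ≡ true) → x ≢ u' →
              v ∈ B u u' e' → v ∈ B x u e
    star-∈B e e' x≢u' = proj₂ (tame _ _ _ e (adj-sym e') x≢u') ∘ B-reverse⊆A (adj-sym e') e'

    ∈B-toward : ∀ {u u' w v} (e : adj u u' ≡ true) (p : Walk adj u' w) →
                IsPath adj (u ∷⟨ e ⟩ p) → int w v → v ∈ B u u' e
    ∈B-toward e [ _ ]         _              v∈w = v∈w _ e
    ∈B-toward e (_ ∷⟨ e' ⟩ p) (u∉p ∷ path-p) v∈w =
      star-∈B e e' (All.lookup u∉p (there (start∈vertices p))) (∈B-toward e' p path-p v∈w)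

    ∈A∩B⇒int : ∀ {u u' v} (e : adj u u' ≡ true) → v ∈ A u u' e → v ∈ B u u' e → int u' v
    ∈A∩B⇒int {u} e v∈A v∈B x ex with x ≟ u
    ... | yes refl = subst (λ e → _ ∈ B _ _ e) (≡true-irrelevant e ex) v∈B
    ... | no x≢u   = star-∈B ex (adj-sym e) x≢u (A⊆B-reverse e (adj-sym e) v∈A)

    int-along-path : ∀ {u w v t} (p : Walk adj u w) → IsPath adj p →
                     int u v → int w v → t ∈ᴸ vertices adj p → int t v
    int-along-path [ _ ]        _ v∈u _ (here refl) = v∈u
    int-along-path [ _ ]        _ _   _ (there ())
    int-along-path (_ ∷⟨ _ ⟩ _) _ v∈u _ (here refl) = v∈u
    int-along-path {v = v} (_∷⟨_⟩_ _ {u'} e p) path@(_ ∷ path-p) v∈u v∈w (there t∈p) =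
      int-along-path p path-p v∈u' v∈w t∈p
      where
      v∈u' : int u' v
      v∈u' = ∈A∩B⇒int e (B-reverse⊆A e (adj-sym e) (v∈u _ (adj-sym e))) (∈B-toward e p path v∈w)

    int∩int≐A∩B : ∀ t t' (e : adj t t' ≡ true) →
                  (λ v → int t v × int t' v) ≐ (λ v → v ∈ A t t' e × v ∈ B t t' e)
    int∩int≐A∩B t t' e =
      (λ (v∈t , v∈t') → B-reverse⊆A e (adj-sym e) (v∈t t' (adj-sym e)) , v∈t' t e) ,
      (λ (v∈A , v∈B) → ∈A∩B⇒int (adj-sym e) (B-reverse⊆A (adj-sym e) e v∈B)
                                            (A⊆B-reverse e (adj-sym e) v∈A)
                     , ∈A∩B⇒int e v∈A v∈B)

lemma5p1 : (G : Graph) (S : STree G) → STree.Tame S →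
    IsTreeDecomposition G (STree.T S) (STree.int S) ×
    (∀ t t' (e : Tree.adj (STree.T S) t t' ≡ true) →
      let A = proj₁ (STree.α S t t' e)
          B = proj₂ (STree.α S t t' e)
      in (λ v → STree.int S t v × STree.int S t' v) ≐ (λ v → v ∈ A × v ∈ B))
lemma5p1 G S tame =
  (vertex-covered , edge-covered ,
   λ { _ _ _ (p , path , t₂∈p) _ v∈t₁ v∈t₃ → int-along-path tame p path v∈t₁ v∈t₃ t₂∈p }) ,
  int∩int≐A∩B tame
  where open STreeProperties S
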